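{- If $A$ is a classical type and $A\triangleleft B$ or $A\approx B$, then $B$ is a classical type.
   Context: Types of $M2$: second-order formulas built from $\perp$ and atomic formulas $R(t_1,\dots,t_k)$ using $\rightarrow,\forall x,\forall X$, where besides ordinary predicate variables there are classical predicate variables $X_C$ (of each arity). A type ends with $X$ if it is $X(\vec t)$, or $A\rightarrow B$ with $B$ ending with $X$, or $\forall vA$ with $A$ ending with $X$; a classical type is a type ending with $\perp$ or with a classical variable. A fixed set of equations is given and $u\approx v$ means $u=v$ follows from it (with $u=v$ abbreviating $\forall Y(Y(u)\rightarrow Y(v))$). On types, $\approx$ is the least reflexive transitive relation with $C[u/x]\approx C[v/x]$ whenever $u\approx v$; $\triangleleft$ is the least reflexive transitive relation with $\forall xA\triangleleft A[u/x]$ for every first-order term $u$, $\forall XA\triangleleft A[F/X]$ for every formula $F$ and ordinary variable $X$, and $\forall X_CA\triangleleft A[G/X_C]$ for every classical type $G$. -}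

module Defs where

open import Data.Nat using (ℕ; zero; suc; _+_)
open import Data.Fin using (Fin; zero; suc; _↑ˡ_; _↑ʳ_; splitAt)
open import Data.Sum using (_⊎_; inj₁; inj₂; [_,_]′)
open import Data.Product using (_×_; _,_)
open import Data.List using (List; _∷_)
open import Data.List.Membership.Propositional using (_∈_)
open import Data.List.Relation.Unary.Any using (here; there)
open import Relation.Binary.PropositionalEquality using (_≡_; refl)
open import Relation.Binary.Construct.Closure.ReflexiveTransitive using (Star)
open import Function using (_∘_)

record Signature : Set₁ where
  field
    Fun   : Set
    farity : Fun → ℕ
    Rel   : Set
    rarity : Rel → ℕ
open Signature public

data Term (sig : Signature) (n : ℕ) : Set where
  var : Fin n → Term sig n
  app : (f : Fun sig) → (Fin (farity sig f) → Term sig n) → Term sig n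

module _ {sig : Signature} where

  substT : ∀ {n m} → Term sig n → (Fin n → Term sig m) → Term sig m
  substT (var i)    σ = σ i
  substT (app f ts) σ = app f (λ i → substT (ts i) σ)

  renT : ∀ {n m} → (Fin n → Fin m) → Term sig n → Term sig m
  renT ρ t = substT t (var ∘ ρ)

record Equations (sig : Signature) : Set₁ where
  field
    Eqn   : Set
    evars : Eqn → ℕ
    lhs   : (e : Eqn) → Term sig (evars e)
    rhs   : (e : Eqn) → Term sig (evars e)
open Equations public

data _⊢_≈ₜ_ {sig : Signature} (E : Equations sig) {n : ℕ} :
            Term sig n → Term sig n → Set where
  ≈refl  : ∀ {t} → E ⊢ t ≈ₜ t
  ≈sym   : ∀ {t u} → E ⊢ t ≈ₜ u → E ⊢ u ≈ₜ t
  ≈trans : ∀ {t u v} → E ⊢ t ≈ₜ u → E ⊢ u ≈ₜ v → E ⊢ t ≈ₜ v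
  ≈cong  : ∀ f {ts us : Fin (farity sig f) → Term sig n} →
           (∀ i → E ⊢ ts i ≈ₜ us i) → E ⊢ app f ts ≈ₜ app f us
  ≈ax    : ∀ (e : Eqn E) (σ : Fin (evars E e) → Term sig n) →
           E ⊢ substT (lhs E e) σ ≈ₜ substT (rhs E e) σ

-- Predicate variables are ordinary or classical, each with an arity;
-- Γ lists the predicate variables in scope (de Bruijn), n is the number
-- of first-order variables in scope.

data Kind : Set where
  ordinary classical : Kind

PCtx : Set
PCtx = List (Kind × ℕ)

data Form (sig : Signature) (n : ℕ) (Γ : PCtx) : Set where
  ⊥̇    : Form sig n Γ
  rel  : (R : Rel sig) → (Fin (rarity sig R) → Term sig n) → Form sig n Γ
  pvar : ∀ {c k} → (c , k) ∈ Γ → (Fin k → Term sig n) → Form sig n Γ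
  _⇒_  : Form sig n Γ → Form sig n Γ → Form sig n Γ
  ∀¹   : Form sig (suc n) Γ → Form sig n Γ
  ∀²   : (c : Kind) (k : ℕ) → Form sig n ((c , k) ∷ Γ) → Form sig n Γ

infixr 5 _⇒_

module _ {sig : Signature} where

  liftT : ∀ {n m} → (Fin n → Term sig m) → Fin (suc n) → Term sig (suc m)
  liftT σ zero    = var zero
  liftT σ (suc i) = renT suc (σ i)

  subst¹ : ∀ {n m Γ} → Form sig n Γ → (Fin n → Term sig m) → Form sig m Γ
  subst¹ ⊥̇          σ = ⊥̇
  subst¹ (rel R ts)  σ = rel R (λ i → substT (ts i) σ)
  subst¹ (pvar x ts) σ = pvar x (λ i → substT (ts i) σ)
  subst¹ (A ⇒ B)     σ = subst¹ A σ ⇒ subst¹ B σ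
  subst¹ (∀¹ A)      σ = ∀¹ (subst¹ A (liftT σ))
  subst¹ (∀² c k A)  σ = ∀² c k (subst¹ A σ)

  _[_/x] : ∀ {n Γ} → Form sig (suc n) Γ → Term sig n → Form sig n Γ
  A [ u /x] = subst¹ A (λ { zero → u ; (suc i) → var i })

  ren² : ∀ {n Γ Δ} → (∀ {p} → p ∈ Γ → p ∈ Δ) → Form sig n Γ → Form sig n Δ
  ren² ρ ⊥̇          = ⊥̇
  ren² ρ (rel R ts)  = rel R ts
  ren² ρ (pvar x ts) = pvar (ρ x) ts
  ren² ρ (A ⇒ B)     = ren² ρ A ⇒ ren² ρ B
  ren² ρ (∀¹ A)      = ∀¹ (ren² ρ A)
  ren² ρ (∀² c k A)  = ∀² c k (ren² (λ { (here e) → here e ; (there x) → there (ρ x) }) A)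

  -- A comprehension of arity k over n first-order variables is a formula
  -- whose first k first-order variables are the abstracted arguments.
  Subst² : ℕ → PCtx → PCtx → Set
  Subst² n Γ Δ = ∀ {c k} → (c , k) ∈ Γ → Form sig (k + n) Δ

  idc : ∀ {n Δ c k} → (c , k) ∈ Δ → Form sig (k + n) Δ
  idc {n} x = pvar x (λ i → var (i ↑ˡ n))

  liftR : ∀ {k n m} → (Fin n → Fin m) → Fin (k + n) → Fin (k + m)
  liftR {k} {n} {m} ρ i = [ (λ j → j ↑ˡ m) , (λ j → k ↑ʳ ρ j) ]′ (splitAt k i)

  subst² : ∀ {n Γ Δ} → Form sig n Γ → Subst² n Γ Δ → Form sig n Δ
  subst² ⊥̇          σ = ⊥̇
  subst² (rel R ts)  σ = rel R ts
  subst² {n} (pvar {k = k} x ts) σ =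
    subst¹ (σ x) (λ i → [ ts , var ]′ (splitAt k i))
  subst² (A ⇒ B)     σ = subst² A σ ⇒ subst² B σ
  subst² (∀¹ A)      σ =
    ∀¹ (subst² A (λ {_} {k} x → subst¹ (σ x) (var ∘ liftR {k} suc)))
  subst² (∀² c k A)  σ =
    ∀² c k (subst² A (λ { (here refl) → idc (here refl)
                        ; (there x)   → ren² there (σ x) }))

  _[_/X] : ∀ {n Γ c k} → Form sig n ((c , k) ∷ Γ) → Form sig (k + n) Γ → Form sig n Γ
  A [ F /X] = subst² A (λ { (here refl) → F ; (there x) → idc x })

  data EndsWith⊥ {n Γ} : Form sig n Γ → Set where
    end⊥ : EndsWith⊥ ⊥̇
    end⇒ : ∀ {A B} → EndsWith⊥ B → EndsWith⊥ (A ⇒ B)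
    end∀¹ : ∀ {A} → EndsWith⊥ A → EndsWith⊥ (∀¹ A)
    end∀² : ∀ {c k A} → EndsWith⊥ A → EndsWith⊥ (∀² c k A)

  data EndsWithClassicalVar {n Γ} : Form sig n Γ → Set where
    endX  : ∀ {k} (x : (classical , k) ∈ Γ) (ts : Fin k → Term sig n) →
            EndsWithClassicalVar (pvar x ts)
    end⇒  : ∀ {A B} → EndsWithClassicalVar B → EndsWithClassicalVar (A ⇒ B)
    end∀¹ : ∀ {A} → EndsWithClassicalVar A → EndsWithClassicalVar (∀¹ A)
    end∀² : ∀ {c k A} → EndsWithClassicalVar A → EndsWithClassicalVar (∀² c k A)

  ClassicalType : ∀ {n Γ} → Form sig n Γ → Set
  ClassicalType A = EndsWith⊥ A ⊎ EndsWithClassicalVar A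

  data ◁step {n Γ} : Form sig n Γ → Form sig n Γ → Set where
    inst¹ : ∀ (A : Form sig (suc n) Γ) (u : Term sig n) →
            ◁step (∀¹ A) (A [ u /x])
    inst² : ∀ {k} (A : Form sig n ((ordinary , k) ∷ Γ)) (F : Form sig (k + n) Γ) →
            ◁step (∀² ordinary k A) (A [ F /X])
    instC : ∀ {k} (A : Form sig n ((classical , k) ∷ Γ)) (G : Form sig (k + n) Γ) →
            ClassicalType G → ◁step (∀² classical k A) (A [ G /X])

  _◁_ : ∀ {n Γ} → Form sig n Γ → Form sig n Γ → Set
  _◁_ = Star ◁step

  data ≈step (E : Equations sig) {n Γ} : Form sig n Γ → Form sig n Γ → Set where
    ≈ctx : ∀ (C : Form sig (suc n) Γ) {u v : Term sig n} →
           E ⊢ u ≈ₜ v → ≈step E (C [ u /x]) (C [ v /x])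

  _⊢_≈_ : ∀ {n Γ} → Equations sig → Form sig n Γ → Form sig n Γ → Set
  E ⊢ A ≈ B = Star (≈step E) A B

module Submission where

-- Being classical is a property of the *ending* of a type: the atom
-- reached by descending through implication conclusions and quantifier
-- bodies.  The proof rests on three invariance facts about endings:
--   * first-order substitution A ↦ A[σ] neither creates nor destroys an
--     ending with ⊥ or with a classical variable (it only touches terms);
--   * renaming predicate variables along a kind-preserving map keeps
--     classical variables classical;
--   * a second-order substitution that sends every classical variable to
--     a classical type maps classical types to classical types.
-- A ◁-step strips a quantifier (keeping the ending) and then performs one
-- of these substitutions; for instC the side condition "G is classical"
-- is exactly what makes the second-order substitution classicality
-- respecting.  An ≈-step relates C[u/x] and C[v/x]; reflecting through
-- the first substitution shows C classical, preserving through the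
-- second shows C[v/x] classical.

open import Defs
open import Data.Nat using (ℕ; suc)
open import Data.Fin using (Fin)
open import Data.Sum using (_⊎_; inj₁; inj₂)
import Data.Sum as Sum
open import Data.Product using (_,_)
open import Data.List using (_∷_)
open import Data.List.Membership.Propositional using (_∈_)
open import Data.List.Relation.Unary.Any using (here; there)
open import Relation.Binary.PropositionalEquality using (refl)
open import Relation.Binary.Construct.Closure.ReflexiveTransitive using (Star; fold)
open import Function using (id; _∘_)

module _ {sig : Signature} where

  ⇒-classical : ∀ {n Γ} {A B : Form sig n Γ} →
                ClassicalType B → ClassicalType (A ⇒ B)
  ⇒-classical = Sum.map end⇒ end⇒

  ∀¹-classical : ∀ {n Γ} {A : Form sig (suc n) Γ} →
                 ClassicalType A → ClassicalType (∀¹ A)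
  ∀¹-classical = Sum.map end∀¹ end∀¹

  ∀²-classical : ∀ {n Γ c k} {A : Form sig n ((c , k) ∷ Γ)} →
                 ClassicalType A → ClassicalType (∀² c k A)
  ∀²-classical = Sum.map end∀² end∀²

  ∀¹-classical⁻¹ : ∀ {n Γ} {A : Form sig (suc n) Γ} →
                   ClassicalType (∀¹ A) → ClassicalType A
  ∀¹-classical⁻¹ = Sum.map (λ { (end∀¹ e) → e }) (λ { (end∀¹ e) → e })

  ∀²-classical⁻¹ : ∀ {n Γ c k} {A : Form sig n ((c , k) ∷ Γ)} →
                   ClassicalType (∀² c k A) → ClassicalType A
  ∀²-classical⁻¹ = Sum.map (λ { (end∀² e) → e }) (λ { (end∀² e) → e })

  classical-atom : ∀ {n Γ k} (x : (classical , k) ∈ Γ) (ts : Fin k → Term sig n) →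
                   ClassicalType (pvar x ts)
  classical-atom x ts = inj₂ (endX x ts)

  -- First-order substitution preserves endings: it changes only the
  -- argument terms of atoms, never which atom a type ends with.

  subst¹-ends⊥ : ∀ {n m Γ} {A : Form sig n Γ} (σ : Fin n → Term sig m) →
                 EndsWith⊥ A → EndsWith⊥ (subst¹ A σ)
  subst¹-ends⊥ σ end⊥      = end⊥
  subst¹-ends⊥ σ (end⇒ e)  = end⇒ (subst¹-ends⊥ σ e)
  subst¹-ends⊥ σ (end∀¹ e) = end∀¹ (subst¹-ends⊥ (liftT σ) e)
  subst¹-ends⊥ σ (end∀² e) = end∀² (subst¹-ends⊥ σ e)

  subst¹-endsX : ∀ {n m Γ} {A : Form sig n Γ} (σ : Fin n → Term sig m) →
                 EndsWithClassicalVar A → EndsWithClassicalVar (subst¹ A σ)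
  subst¹-endsX σ (endX x ts) = endX x _
  subst¹-endsX σ (end⇒ e)    = end⇒ (subst¹-endsX σ e)
  subst¹-endsX σ (end∀¹ e)   = end∀¹ (subst¹-endsX (liftT σ) e)
  subst¹-endsX σ (end∀² e)   = end∀² (subst¹-endsX σ e)

  subst¹-classical : ∀ {n m Γ} {A : Form sig n Γ} (σ : Fin n → Term sig m) →
                     ClassicalType A → ClassicalType (subst¹ A σ)
  subst¹-classical σ = Sum.map (subst¹-ends⊥ σ) (subst¹-endsX σ)

  -- Conversely, first-order substitution reflects endings: an ending of
  -- A[σ] can only come from the corresponding ending of A, since
  -- substitution never turns a relation atom into ⊥ or a predicate atom.

  subst¹-ends⊥⁻¹ : ∀ {n m Γ} (A : Form sig n Γ) (σ : Fin n → Term sig m) →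
                   EndsWith⊥ (subst¹ A σ) → EndsWith⊥ A
  subst¹-ends⊥⁻¹ ⊥̇          σ e         = end⊥
  subst¹-ends⊥⁻¹ (rel R ts)  σ ()
  subst¹-ends⊥⁻¹ (pvar x ts) σ ()
  subst¹-ends⊥⁻¹ (A ⇒ B)     σ (end⇒ e)  = end⇒ (subst¹-ends⊥⁻¹ B σ e)
  subst¹-ends⊥⁻¹ (∀¹ A)      σ (end∀¹ e) = end∀¹ (subst¹-ends⊥⁻¹ A (liftT σ) e)
  subst¹-ends⊥⁻¹ (∀² c k A)  σ (end∀² e) = end∀² (subst¹-ends⊥⁻¹ A σ e)

  subst¹-endsX⁻¹ : ∀ {n m Γ} (A : Form sig n Γ) (σ : Fin n → Term sig m) →
                   EndsWithClassicalVar (subst¹ A σ) → EndsWithClassicalVar A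
  subst¹-endsX⁻¹ ⊥̇          σ ()
  subst¹-endsX⁻¹ (rel R ts)  σ ()
  subst¹-endsX⁻¹ (pvar x ts) σ (endX .x _) = endX x ts
  subst¹-endsX⁻¹ (A ⇒ B)     σ (end⇒ e)    = end⇒ (subst¹-endsX⁻¹ B σ e)
  subst¹-endsX⁻¹ (∀¹ A)      σ (end∀¹ e)   = end∀¹ (subst¹-endsX⁻¹ A (liftT σ) e)
  subst¹-endsX⁻¹ (∀² c k A)  σ (end∀² e)   = end∀² (subst¹-endsX⁻¹ A σ e)

  subst¹-classical⁻¹ : ∀ {n m Γ} (A : Form sig n Γ) (σ : Fin n → Term sig m) →
                       ClassicalType (subst¹ A σ) → ClassicalType A
  subst¹-classical⁻¹ A σ = Sum.map (subst¹-ends⊥⁻¹ A σ) (subst¹-endsX⁻¹ A σ)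

  ren²-classical : ∀ {n Γ Δ} {A : Form sig n Γ} (ρ : ∀ {p} → p ∈ Γ → p ∈ Δ) →
                   ClassicalType A → ClassicalType (ren² ρ A)
  ren²-classical ρ = Sum.map (ends⊥ ρ) (endsX ρ)
    where
    ends⊥ : ∀ {n Γ Δ} {A : Form sig n Γ} (ρ : ∀ {p} → p ∈ Γ → p ∈ Δ) →
            EndsWith⊥ A → EndsWith⊥ (ren² ρ A)
    ends⊥ ρ end⊥      = end⊥
    ends⊥ ρ (end⇒ e)  = end⇒ (ends⊥ ρ e)
    ends⊥ ρ (end∀¹ e) = end∀¹ (ends⊥ ρ e)
    ends⊥ ρ (end∀² e) = end∀² (ends⊥ _ e)

    endsX : ∀ {n Γ Δ} {A : Form sig n Γ} (ρ : ∀ {p} → p ∈ Γ → p ∈ Δ) →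
            EndsWithClassicalVar A → EndsWithClassicalVar (ren² ρ A)
    endsX ρ (endX x ts) = endX (ρ x) ts
    endsX ρ (end⇒ e)    = end⇒ (endsX ρ e)
    endsX ρ (end∀¹ e)   = end∀¹ (endsX ρ e)
    endsX ρ (end∀² e)   = end∀² (endsX _ e)

  RespectsClassical : ∀ {n Γ Δ} → Subst² {sig} n Γ Δ → Set
  RespectsClassical {Γ = Γ} σ = ∀ {k} (x : (classical , k) ∈ Γ) → ClassicalType (σ x)

  subst²-ends⊥ : ∀ {n Γ Δ} {A : Form sig n Γ} (σ : Subst² {sig} n Γ Δ) →
                 EndsWith⊥ A → EndsWith⊥ (subst² A σ)
  subst²-ends⊥ σ end⊥      = end⊥
  subst²-ends⊥ σ (end⇒ e)  = end⇒ (subst²-ends⊥ σ e)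
  subst²-ends⊥ σ (end∀¹ e) = end∀¹ (subst²-ends⊥ _ e)
  subst²-ends⊥ σ (end∀² e) = end∀² (subst²-ends⊥ _ e)

  -- An ending with a classical variable X_C becomes the ending of σ(X_C),
  -- which is classical by assumption.

  subst²-endsX : ∀ {n Γ Δ} {A : Form sig n Γ} (σ : Subst² {sig} n Γ Δ) →
                 RespectsClassical {n} {Γ} {Δ} σ →
                 EndsWithClassicalVar A → ClassicalType (subst² A σ)
  subst²-endsX σ resp (endX x ts) = subst¹-classical _ (resp x)
  subst²-endsX σ resp (end⇒ e)    = ⇒-classical (subst²-endsX σ resp e)
  subst²-endsX σ resp (end∀¹ e)   =
    ∀¹-classical (subst²-endsX _ (λ x → subst¹-classical _ (resp x)) e)
  subst²-endsX σ resp (end∀² e)   =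
    ∀²-classical (subst²-endsX _ (λ { (here refl) → classical-atom (here refl) _
                                    ; (there x)   → ren²-classical there (resp x) }) e)

  subst²-classical : ∀ {n Γ Δ} {A : Form sig n Γ} (σ : Subst² {sig} n Γ Δ) →
                     RespectsClassical {n} {Γ} {Δ} σ →
                     ClassicalType A → ClassicalType (subst² A σ)
  subst²-classical σ resp (inj₁ e) = inj₁ (subst²-ends⊥ σ e)
  subst²-classical σ resp (inj₂ e) = subst²-endsX σ resp e

  -- Instantiating an
  -- ordinary variable respects classicality vacuously at the bound
  -- variable; instantiating a classical one uses the side condition on G.

  ◁step-classical : ∀ {n Γ} {A B : Form sig n Γ} →
                    ◁step A B → ClassicalType A → ClassicalType B
  ◁step-classical (inst¹ A u) c =
    subst¹-classical _ (∀¹-classical⁻¹ c)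
  ◁step-classical (inst² A F) c =
    subst²-classical _ (λ { (here ()) ; (there x) → classical-atom x _ }) (∀²-classical⁻¹ c)
  ◁step-classical (instC A G classicalG) c =
    subst²-classical _ (λ { (here refl) → classicalG ; (there x) → classical-atom x _ })
                       (∀²-classical⁻¹ c)

  -- One congruence step C[u/x] ≈ C[v/x] preserves classicality: the
  -- context C is classical (reflection), hence so is C[v/x].

  ≈step-classical : ∀ {E n Γ} {A B : Form sig n Γ} →
                    ≈step E A B → ClassicalType A → ClassicalType B
  ≈step-classical (≈ctx C _) c = subst¹-classical _ (subst¹-classical⁻¹ C _ c)

  Star-classical : ∀ {n Γ} {R : Form sig n Γ → Form sig n Γ → Set} →
                   (∀ {A B} → R A B → ClassicalType A → ClassicalType B) →
                   ∀ {A B} → Star R A B → ClassicalType A → ClassicalType B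
  Star-classical step =
    fold (λ A B → ClassicalType A → ClassicalType B) (λ r rest → rest ∘ step r) id

lemma3p1 : (sig : Signature) (E : Equations sig) {n : ℕ} {Γ : PCtx}
    (A B : Form sig n Γ) →
    ClassicalType A → (A ◁ B) ⊎ (E ⊢ A ≈ B) → ClassicalType B
lemma3p1 sig E A B c (inj₁ A◁B) = Star-classical ◁step-classical A◁B c
lemma3p1 sig E A B c (inj₂ A≈B) = Star-classical ≈step-classical A≈B c
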